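{- Let $\overline{\mathsf{M}} = \langle I, \{S_{\Phi}\}_{\Phi \subseteq \mathsf{At}}, (r^{\Phi}_{\Psi})_{\Psi \subseteq \Phi \subseteq \mathsf{At}}, (\Pi_i)_{i \in I}, (\Lambda_i)_{i \in I}, v \rangle$ be a complemented HMS model (Coherence). For any individual $i \in I$ and any $\omega \in \Omega$, $\Lambda_i(\omega)_{S_{\Pi_i(\omega)}} = \Pi_i(\omega)$.
   Context: Fix a nonempty set $\mathsf{At}$ of atomic formulas. An HMS model $\langle I, \{S_{\Phi}\}_{\Phi \subseteq \mathsf{At}}, (r^{\Phi}_{\Psi})_{\Psi \subseteq \Phi \subseteq \mathsf{At}}, (\Pi_i)_{i \in I}, v \rangle$ consists of: a nonempty set $I$ of individuals; for each $\Phi \subseteq \mathsf{At}$ a nonempty state space $S_\Phi$, the spaces pairwise disjoint and ordered by $S_\Psi \preceq S_\Phi$ iff $\Psi \subseteq \Phi$; $\Omega := \bigcup_{\Phi} S_\Phi$; surjections $r^\Phi_\Psi : S_\Phi \to S_\Psi$ for $\Psi \subseteq \Phi$ with $r^\Phi_\Phi$ the identity and $r^\Phi_\Upsilon = r^\Psi_\Upsilon \circ r^\Phi_\Psi$ for $\Upsilon \subseteq \Psi \subseteq \Phi$; possibility correspondences $\Pi_i : \Omega \to 2^\Omega \setminus \{\emptyset\}$; a valuation $v$ from $\mathsf{At}$ to events. Notation: $\omega_\Psi := r^\Phi_\Psi(\omega)$ for $\omega \in S_\Phi$, $\Psi\subseteq\Phi$; $D_\Psi := r^\Phi_\Psi(D)$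 for $D \subseteq S_\Phi$; for a space $S = S_\Psi$, $D_S := D_\Psi$; $D^{\uparrow} := \bigcup_{\Phi \subseteq \Psi \subseteq \mathsf{At}} (r^\Psi_\Phi)^{ -1}(D)$ for $D \subseteq S_\Phi$; $\Pi_i^\uparrow(\omega) := (\Pi_i(\omega))^\uparrow$; $S_{\Pi_i(\omega)}$ is the space containing $\Pi_i(\omega)$. Each $\Pi_i$ satisfies: Confinement (if $\omega \in S_\Phi$ then $\Pi_i(\omega) \subseteq S_\Psi$ for some $\Psi \subseteq \Phi$); Generalized Reflexivity ($\omega \in \Pi_i^\uparrow(\omega)$); Stationarity ($\omega' \in \Pi_i(\omega) \Rightarrow \Pi_i(\omega') = \Pi_i(\omega)$); Projections Preserve Ignorance (if $\omega \in S_\Phi$, $\Psi \subseteq \Phi$ then $\Pi_i^\uparrow(\omega) \subseteq \Pi_i^\uparrow(\omega_\Psi)$); Projections Preserve Knowledge (if $\Upsilon \subseteq \Psi \subseteq \Phi$, $\omega \in S_\Phi$, $\Pi_i(\omega) \subseteq S_\Psi$, then $(\Pi_i(\omega))_\Upsilon = \Pi_i(\omega_\Upsilon)$). A complemented HMS model additionally has, for each $i$, an implicit possibility correspondence $\Lambda_i : \Omega \to 2^\Omega$ satisfying: Reflexivity ($\omega \in \Lambda_i(\omega)$); Stationarity ($\omega' \in \Lambda_i(\omega) \Rightarrow \Lambda_i(\omega') = \Lambda_i(\omega)$); Projections Preserve Implicit Knowledge (if $\omega \in S_\Phi$ then $\Lambda_i(\omega)_\Psi = \Lambda_i(\omega_\Psi)$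 for all $\Psi \subseteq \Phi$); Explicit Measurability ($\omega' \in \Lambda_i(\omega) \Rightarrow \Pi_i(\omega') = \Pi_i(\omega)$); Implicit Measurability ($\omega' \in \Pi_i(\omega) \Rightarrow \Lambda_i(\omega') = \Lambda_i(\omega)_{S_{\Pi_i(\omega)}}$). -}

module Defs where

open import Level using (0ℓ)
open import Data.Product using (Σ; ∃; _×_; _,_; proj₁; proj₂)
open import Relation.Unary using (Pred; _⊆_; _∈_; _≐_)
open import Relation.Binary.PropositionalEquality using (_≡_)

Sub : Set → Set₁
Sub At = Pred At 0ℓ

-- Disjointness of the spaces is automatic since
-- Ω is the dependent sum Σ Φ, S Φ.  The inclusion proof is irrelevant:
-- r^Φ_Ψ depends only on Φ and Ψ.
record HMSFrame (At : Set) : Set₁ where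
  field
    atom   : At
    S      : Sub At → Set
    S-ne   : (Φ : Sub At) → S Φ
    r      : (Φ Ψ : Sub At) → .(Ψ ⊆ Φ) → S Φ → S Ψ
    r-surj : (Φ Ψ : Sub At) .(p : Ψ ⊆ Φ) (y : S Ψ) → ∃ λ x → r Φ Ψ p x ≡ y
    r-id   : (Φ : Sub At) (x : S Φ) → r Φ Φ (λ z → z) x ≡ x
    r-comp : (Φ Ψ Υ : Sub At) (p : Υ ⊆ Ψ) (q : Ψ ⊆ Φ) (x : S Φ) →
             r Φ Υ (λ z → q (p z)) x ≡ r Ψ Υ p (r Φ Ψ q x)

module FrameNotions {At : Set} (F : HMSFrame At) where
  open HMSFrame F

  Ω : Set₁
  Ω = Σ (Sub At) S

  InSpace : Pred Ω 0ℓ → Sub At → Set₁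
  InSpace D Ψ = (x : Ω) → x ∈ D → proj₁ x ≡ Ψ

  prj : (ω : Ω) (Ψ : Sub At) → .(Ψ ⊆ proj₁ ω) → Ω
  prj ω Ψ p = Ψ , r (proj₁ ω) Ψ p (proj₂ ω)

  _⇂_ : {ℓ : _} → Pred Ω ℓ → Sub At → Pred Ω _
  D ⇂ Ψ = λ x → Σ Ω λ y → y ∈ D × Σ (Ψ ⊆ proj₁ y) λ p → x ≡ prj y Ψ p

  up : {ℓ : _} → Sub At → Pred Ω ℓ → Pred Ω _
  up Ψ D = λ y → Σ (Ψ ⊆ proj₁ y) λ p → prj y Ψ p ∈ D

record HMS (At : Set) : Set₂ where
  field
    frame : HMSFrame At
  open HMSFrame frame public
  open FrameNotions frame public
  field
    I  : Set
    I-ne : I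
    Π  : I → Ω → Pred Ω 0ℓ
    Π-ne : (i : I) (ω : Ω) → ∃ λ x → x ∈ Π i ω
    -- valuation: v(p) is the event D^↑ for some D ⊆ S_Φ
    v  : At → Σ (Sub At) λ Φ → Pred (S Φ) 0ℓ
    confinement : (i : I) (ω : Ω) →
      Σ (Sub At) λ Ψ → (Ψ ⊆ proj₁ ω) × InSpace (Π i ω) Ψ

  spaceOf : I → Ω → Sub At
  spaceOf i ω = proj₁ (confinement i ω)

  Π↑ : I → Ω → Pred Ω _
  Π↑ i ω = up (spaceOf i ω) (Π i ω)

  field
    gen-refl    : (i : I) (ω : Ω) → ω ∈ Π↑ i ω
    stationary  : (i : I) (ω ω' : Ω) → ω' ∈ Π i ω → Π i ω' ≐ Π i ω
    ppi         : (i : I) (ω : Ω) (Ψ : Sub At) (p : Ψ ⊆ proj₁ ω) →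
                  Π↑ i ω ⊆ Π↑ i (prj ω Ψ p)
    ppk         : (i : I) (ω : Ω) (Υ Ψ : Sub At) (p : Υ ⊆ Ψ) (q : Ψ ⊆ proj₁ ω) →
                  InSpace (Π i ω) Ψ →
                  (Π i ω ⇂ Υ) ≐ Π i (prj ω Υ (λ z → q (p z)))

record ComplementedHMS (At : Set) : Set₂ where
  field
    hms : HMS At
  open HMS hms public
  field
    Λ : I → Ω → Pred Ω 0ℓ
    Λ-refl       : (i : I) (ω : Ω) → ω ∈ Λ i ω
    Λ-stationary : (i : I) (ω ω' : Ω) → ω' ∈ Λ i ω → Λ i ω' ≐ Λ i ω
    ppik         : (i : I) (ω : Ω) (Ψ : Sub At) (p : Ψ ⊆ proj₁ ω) →
                   (Λ i ω ⇂ Ψ) ≐ Λ i (prj ω Ψ p)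
    explicit-meas : (i : I) (ω ω' : Ω) → ω' ∈ Λ i ω → Π i ω' ≐ Π i ω
    implicit-meas : (i : I) (ω ω' : Ω) → ω' ∈ Π i ω →
                    Λ i ω' ≐ (Λ i ω ⇂ spaceOf i ω)

{-# OPTIONS --safe #-}
-- Pick any w ∈ Πᵢ(ω). By Implicit Measurability Λᵢ(w) = Λᵢ(ω)_S, so a state x of
-- Λᵢ(ω)_S lies in Λᵢ(w) and Explicit Measurability with Stationarity gives
-- Πᵢ(x) = Πᵢ(ω) ⊆ S. Generalized Reflexivity puts the projection of x to the space
-- of Πᵢ(x) = S into Πᵢ(x); as x already lies in S, that projection is x itself.
-- Conversely every y ∈ Πᵢ(ω) satisfies y ∈ Λᵢ(y) = Λᵢ(ω)_S.
module Submission where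

open import Defs
open import Data.Product using (_,_; proj₁; proj₂)
open import Relation.Unary using (Pred; _∈_; _⊆_; _≐_)
open import Relation.Binary.PropositionalEquality using (_≡_; refl; sym; trans; cong; subst)

module _ {At : Set} (F : HMSFrame At) where
  open HMSFrame F
  open FrameNotions F

  ⇂-inSpace : ∀ {ℓ} (D : Pred Ω ℓ) (Ψ : Sub At) {x : Ω} → x ∈ (D ⇂ Ψ) → proj₁ x ≡ Ψ
  ⇂-inSpace D Ψ (_ , _ , _ , refl) = refl

  prj-self : (x : Ω) (Ψ : Sub At) (p : Ψ ⊆ proj₁ x) → Ψ ≡ proj₁ x → prj x Ψ p ≡ x
  prj-self (Ψ , s) .Ψ p refl = cong (Ψ ,_) (r-id Ψ s)

module _ {At : Set} (H : HMS At) where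
  open HMS H

  spaceOf-mono : (i : I) (x ω : Ω) → Π i x ⊆ Π i ω → spaceOf i x ≡ spaceOf i ω
  spaceOf-mono i x ω Πx⊆Πω with Π-ne i x
  ... | z , z∈Πx = trans (sym (proj₂ (proj₂ (confinement i x)) z z∈Πx))
                         (proj₂ (proj₂ (confinement i ω)) z (Πx⊆Πω z∈Πx))

  ∈Π-self : (i : I) (x : Ω) → spaceOf i x ≡ proj₁ x → x ∈ Π i x
  ∈Π-self i x same with gen-refl i x
  ... | p , x↓∈Πx = subst (Π i x) (prj-self frame x (spaceOf i x) p same) x↓∈Πx

module _ {At : Set} (M : ComplementedHMS At) where
  open ComplementedHMS M

  Π-⊆-on-Λ⇂ : (i : I) (ω x : Ω) → x ∈ (Λ i ω ⇂ spaceOf i ω) → Π i x ⊆ Π i ω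
  Π-⊆-on-Λ⇂ i ω x x∈Λω⇂ with Π-ne i ω
  ... | w , w∈Πω = λ z∈Πx →
    proj₁ (stationary i ω w w∈Πω) (proj₁ (explicit-meas i w x x∈Λw) z∈Πx)
    where
      x∈Λw : x ∈ Λ i w
      x∈Λw = proj₂ (implicit-meas i ω w w∈Πω) x∈Λω⇂

lemma6 : (At : Set) (M : ComplementedHMS At) →
    let open ComplementedHMS M in
    (i : I) (ω : Ω) → (Λ i ω ⇂ spaceOf i ω) ≐ Π i ω
lemma6 At M i ω = Λ⇂⊆Π , Π⊆Λ⇂
  where
    open ComplementedHMS M

    Λ⇂⊆Π : (Λ i ω ⇂ spaceOf i ω) ⊆ Π i ω
    Λ⇂⊆Π {x} x∈Λω⇂ = Πx⊆Πω (∈Π-self hms i x (trans (spaceOf-mono hms i x ω Πx⊆Πω) (sym x-in-S)))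
      where
        Πx⊆Πω : Π i x ⊆ Π i ω
        Πx⊆Πω = Π-⊆-on-Λ⇂ M i ω x x∈Λω⇂

        x-in-S : proj₁ x ≡ spaceOf i ω
        x-in-S = ⇂-inSpace frame (Λ i ω) (spaceOf i ω) x∈Λω⇂

    Π⊆Λ⇂ : Π i ω ⊆ (Λ i ω ⇂ spaceOf i ω)
    Π⊆Λ⇂ {y} y∈Πω = proj₁ (implicit-meas i ω y y∈Πω) (Λ-refl i y)
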